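{- Let $\Phi'$ be a tight derivation in system $\mathcal{N}$ of $\Gamma\vdash^{(m',e',s)} t':\sigma$. If $t\to_{dn}t'$, then there is a derivation $\Phi$ in system $\mathcal{N}$ of $\Gamma\vdash^{(m,e,s)} t:\sigma$ such that: (1) $m'=m-1$ and $e'=e$ if $t\to_{dn}t'$ is an $m$-step; (2) $e'=e-1$ and $m'=m$ if $t\to_{dn}t'$ is an $e$-step.
   Context: Terms are $t,u,r ::= x \mid \lambda x.t \mid t\,u \mid t[x\backslash u]$ over a countably infinite set of variables, where $t[x\backslash u]$ (explicit substitution) binds $x$ in $t$; terms are taken modulo $\alpha$-conversion and $t\{x:=u\}$ is capture-avoiding meta-level substitution. List contexts are $L ::= \square \mid L[x\backslash t]$, and $L\langle t\rangle$ plugs $t$ into the hole. The deterministic CBN relation $\to_{dn}$ is the least relation closed under: $(L\langle\lambda x.t\rangle)\,u\to_{dn}L\langle t[x\backslash u]\rangle$ (an $m$-step); $t[x\backslash u]\to_{dn}t\{x:=u\}$ (an $e$-step); if $t\to_{dn}s$ and $t$ is not of the form $L\langle\lambda y.r\rangle$ then $t\,u\to_{dn}s\,u$; if $t\to_{dn}s$ then $\lambda x.t\to_{dn}\lambda x.s$. A step is an $m$-step or an $e$-step according to which of the two axioms it applies at its base. Types. Tight types: $\mathtt{tt} ::= \mathtt{n} \mid \mathtt{a}$. Types: $\sigma,\tau ::= \mathtt{tt} \mid \mathcal{M} \mid \mathcal{M}\to\sigma$, where multitypes $\mathcal{M} = [\sigma_i]_{i\in I}$ are finite multisets of types ($[\,]$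 empty, $\sqcup$ union). A typing context $\Gamma$ maps variables to multitypes, $[\,]$ for all but finitely many; $\mathrm{dom}(\Gamma)=\{x \mid \Gamma(x)\neq[\,]\}$; $(\Gamma+\Delta)(x) = \Gamma(x)\sqcup\Delta(x)$, extended to finite sums $+_{i\in I}\Gamma_i$; $\Gamma\setminus\!\!\setminus x$ maps $x$ to $[\,]$ and agrees with $\Gamma$ elsewhere; $\Gamma; x:\mathcal{M}$ maps $x$ to $\mathcal{M}$ and agrees with $\Gamma$ elsewhere, where $x\notin\mathrm{dom}(\Gamma)$. Judgements $\Gamma \vdash^{(m,e,s)} t:\sigma$ carry natural-number counters. System $\mathcal{N}$ consists of the rules: (app$_p$) from $\Gamma\vdash^{(m,e,s)} t:\mathtt{n}$ infer $\Gamma\vdash^{(m,e,s+1)} t\,u:\mathtt{n}$; (abs$_p$) from $\Gamma\vdash^{(m,e,s)} t:\mathtt{tt}$ (a tight type) with $\Gamma(x)$ tight, infer $\Gamma\setminus\!\!\setminus x\vdash^{(m,e,s+1)}\lambda x.t:\mathtt{a}$; (var$_c$) $x:[\sigma]\vdash^{(0,0,0)} x:\sigma$; (abs$_c$) from $\Gamma\vdash^{(m,e,s)} t:\tau$ infer $\Gamma\setminus\!\!\setminus x\vdash^{(m,e,s)}\lambda x.t:\Gamma(x)\to\tau$; (app$_c$) from $\Gamma\vdash^{(m,e,s)} t:[\sigma_i]_{i\in I}\to\tau$ and $\Delta_i\vdash^{(m_i,e_i,s_i)} u:\sigma_i$ for each $i\in I$, infer $\Gamma+_{i\in I}\Delta_i\vdash^{(1+m+\sum_i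 m_i,\,1+e+\sum_i e_i,\,s+\sum_i s_i)} t\,u:\tau$; (es$_c$) from $\Gamma;x:[\sigma_i]_{i\in I}\vdash^{(m,e,s)} t:\tau$ and $\Delta_i\vdash^{(m_i,e_i,s_i)} u:\sigma_i$ for each $i\in I$, infer $(\Gamma\setminus\!\!\setminus x)+_{i\in I}\Delta_i\vdash^{(m+\sum_i m_i,\,1+e+\sum_i e_i,\,s+\sum_i s_i)} t[x\backslash u]:\tau$. A multitype is tight if all its elements are tight types; a context is tight if all multitypes it assigns are tight; a derivation of $\Gamma\vdash^{(m,e,s)} t:\sigma$ is tight if $\Gamma$ is tight and $\sigma$ is a tight type. -}

module Defs where

open import Data.Nat using (ℕ; zero; suc; _+_; _≡ᵇ_; compare; less; equal; greater)
open import Data.List using (List; []; _∷_; _++_; length)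
open import Data.List.Relation.Unary.All using (All)
open import Data.Bool using (if_then_else_)
open import Data.Product using (Σ; _×_; ∃-syntax)
open import Relation.Binary.PropositionalEquality using (_≡_)
open import Relation.Nullary using (¬_)

-- Terms with explicit substitutions, de Bruijn indices (terms modulo α)
--   var n      : variable
--   lam t      : λx.t   (x is index 0 in t)
--   app t u    : t u
--   es t u     : t[x\u] (x is index 0 in t; u in the outer scope)

data Term : Set where
  var : ℕ → Term
  lam : Term → Term
  app : Term → Term → Term
  es  : Term → Term → Term

shift : ℕ → Term → Term
shift c (var n) with compare n c
... | less _ _    = var n
... | equal _     = var (suc n)
... | greater _ _ = var (suc n)
shift c (lam t)   = lam (shift (suc c) t)
shift c (app t u) = app (shift c t) (shift c u)
shift c (es t u)  = es (shift (suc c) t) (shift c u)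

shiftBy : ℕ → Term → Term
shiftBy zero    t = t
shiftBy (suc k) t = shift 0 (shiftBy k t)

-- sub k u t : capture-avoiding substitution of u (given in the scope
-- outside the k binders) for variable k in t, decrementing variables > k.
sub : ℕ → Term → Term → Term
sub k u (var n) with compare n k
... | less _ _    = var n
... | equal _     = shiftBy k u
... | greater _ l = var (k + l)
sub k u (lam t)   = lam (sub (suc k) u t)
sub k u (app t r) = app (sub k u t) (sub k u r)
sub k u (es t r)  = es (sub (suc k) u t) (sub k u r)

_[0≔_] : Term → Term → Term
t [0≔ u ] = sub 0 u t

-- List contexts  L ::= □ | L[x\t]
-- represented as a list whose head is the outermost substitution:
--   plug [] s = s ;  plug (t ∷ L) s = (plug L s)[x\t]

LCtx : Set
LCtx = List Term

plug : LCtx → Term → Term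
plug []      s = s
plug (t ∷ L) s = es (plug L s) t

IsLAbs : Term → Set
IsLAbs t = ∃[ L ] ∃[ r ] (t ≡ plug L (lam r))

data Kind : Set where
  m-step e-step : Kind

data _⟶dn[_]_ : Term → Kind → Term → Set where
  dB   : ∀ L t u → app (plug L (lam t)) u ⟶dn[ m-step ] plug L (es t (shiftBy (length L) u))
  sb   : ∀ t u → es t u ⟶dn[ e-step ] (t [0≔ u ])
  appL : ∀ {k t s} u → t ⟶dn[ k ] s → ¬ IsLAbs t → app t u ⟶dn[ k ] app s u
  absC : ∀ {k t s} → t ⟶dn[ k ] s → lam t ⟶dn[ k ] lam s

-- Types and multitypes (multitypes = finite multisets, as lists;
-- multiset equality is permutation)

data Ty : Set where
  n a : Ty
  mt  : List Ty → Ty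
  _⇒_ : List Ty → Ty → Ty

MTy : Set
MTy = List Ty

data Tight : Ty → Set where
  tight-n : Tight n
  tight-a : Tight a

TightMTy : MTy → Set
TightMTy M = All Tight M

Ctx : Set
Ctx = ℕ → MTy

TightCtx : Ctx → Set
TightCtx Γ = ∀ x → TightMTy (Γ x)

∅ : Ctx
∅ _ = []

_+ᶜ_ : Ctx → Ctx → Ctx
(Γ +ᶜ Δ) x = Γ x ++ Δ x

_∶[_] : ℕ → Ty → Ctx
(x ∶[ σ ]) y = if x ≡ᵇ y then σ ∷ [] else []

-- For a body context Γ of a binder (bound variable = index 0):
--   Γ 0 is Γ(x), and  (λ y → Γ (suc y))  is Γ \\ x  seen outside the binder.
tailᶜ : Ctx → Ctx
tailᶜ Γ y = Γ (suc y)

-- System N.   N Γ t σ m e s  ≡  Γ ⊢^(m,e,s) t : σ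
-- NS Γ u M m e s : a family (Δ_i ⊢^(m_i,e_i,s_i) u : σ_i)_{i} for M = [σ_i]_i,
-- with Γ = +_i Δ_i and m = Σ m_i, e = Σ e_i, s = Σ s_i.

data N : Ctx → Term → Ty → ℕ → ℕ → ℕ → Set
data NS : Ctx → Term → MTy → ℕ → ℕ → ℕ → Set

data N where
  app-p : ∀ {Γ t m e s} u → N Γ t n m e s → N Γ (app t u) n m e (suc s)
  abs-p : ∀ {Γ t τ m e s} → Tight τ → TightMTy (Γ 0) → N Γ t τ m e s
        → N (tailᶜ Γ) (lam t) a m e (suc s)
  var-c : ∀ x σ → N (x ∶[ σ ]) (var x) σ 0 0 0
  abs-c : ∀ {Γ t τ m e s} → N Γ t τ m e s → N (tailᶜ Γ) (lam t) (Γ 0 ⇒ τ) m e s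
  app-c : ∀ {Γ Δ t u M τ m e s m' e' s'} → N Γ t (M ⇒ τ) m e s → NS Δ u M m' e' s'
        → N (Γ +ᶜ Δ) (app t u) τ (suc (m + m')) (suc (e + e')) (s + s')
  es-c  : ∀ {Γ Δ t u τ m e s m' e' s'} → N Γ t τ m e s → NS Δ u (Γ 0) m' e' s'
        → N (tailᶜ Γ +ᶜ Δ) (es t u) τ (m + m') (suc (e + e')) (s + s')

data NS where
  []ˢ  : ∀ {u} → NS ∅ u [] 0 0 0
  _∷ˢ_ : ∀ {Δ Δs u σ σs m e s ms es' ss} → N Δ u σ m e s → NS Δs u σs ms es' ss
       → NS (Δ +ᶜ Δs) u (σ ∷ σs) (m + ms) (e + es') (s + ss)

CounterRel : Kind → ℕ → ℕ → ℕ → ℕ → Set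
CounterRel m-step m e m' e' = (m' + 1 ≡ m) × (e' ≡ e)
CounterRel e-step m e m' e' = (e' + 1 ≡ e) × (m' ≡ m)

-- An e-step t[x\u] → t{x:=u} is reversed by
-- anti-substitution: a typing of t{x:=u} splits into a typing of t and one
-- typing of u for each type that t assigns to x (the copies of u moved under
-- binders are strengthened back to their own scope).  An m-step
-- L⟨λx.t⟩ u → L⟨t[x\u]⟩ is reversed by reading the typing of t[x\u] as an
-- abs-c typing of λx.t plus typings of u, and wrapping λx.t back into the
-- substitutions of L.  Multitypes are lists, so the expanded context is a
-- permutation of the given one.

module Submission where

open import Defs
open import Data.Nat using (ℕ)
open import Data.Product using (Σ; _×_; ∃-syntax)
open import Data.List.Relation.Binary.Permutation.Propositional using (_↭_)

open import Algebra.Bundles using (CommutativeMonoid)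
import Algebra.Properties.CommutativeSemigroup as CommutativeSemigroupProperties
open import Data.Nat using (zero; suc; _+_; _≤_; _<_; s≤s; compare; less; equal; greater)
open import Data.Nat.Properties using (+-comm; +-assoc; +-identityʳ; ≤-refl; m≤m+n; m≤n⇒m≤1+n; +-commutativeSemigroup)
open import Data.List using ([]; _∷_; _++_; length)
open import Data.List.Properties using (++-identityʳ)
open import Data.List.Relation.Binary.Permutation.Propositional
  using (prep; swap; ↭-refl; ↭-sym; ↭-trans; ↭-reflexive; module PermutationReasoning)
import Data.List.Relation.Binary.Permutation.Propositional.Properties as ↭
open import Data.Product using (_,_)
open import Data.Empty using (⊥-elim)
open import Relation.Binary.PropositionalEquality using (_≡_; _≗_; refl; sym; trans; cong; cong₂; subst)

private
  module ℕ+ = CommutativeSemigroupProperties +-commutativeSemigroup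
  module ++↭ = CommutativeSemigroupProperties
    (CommutativeMonoid.commutativeSemigroup (↭.++-commutativeMonoid {A = Ty}))

variable
  Γ Γ′ Γ₁ Γ₂ Γt Γr Δ Δ′ Δ₁ Δ₂ : Ctx
  u : Term
  σ : Ty
  M M′ : MTy
  m e s m₁ e₁ s₁ m₂ e₂ s₂ : ℕ

subst₃ : (P : ℕ → ℕ → ℕ → Set) {m e s m′ e′ s′ : ℕ}
       → m ≡ m′ → e ≡ e′ → s ≡ s′ → P m e s → P m′ e′ s′
subst₃ P refl refl refl p = p

infixr 5 _∷ᶜ_

_∷ᶜ_ : MTy → Ctx → Ctx
(M ∷ᶜ Γ) zero    = M
(M ∷ᶜ Γ) (suc x) = Γ x

insertᶜ : ℕ → MTy → Ctx → Ctx
insertᶜ zero    M Γ = M ∷ᶜ Γ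
insertᶜ (suc c) M Γ = Γ 0 ∷ᶜ insertᶜ c M (tailᶜ Γ)

liftᶜ : ℕ → Ctx → Ctx
liftᶜ zero    Δ = Δ
liftᶜ (suc k) Δ = [] ∷ᶜ liftᶜ k Δ

-- The context of t{k := u} when t is typed in Γ and u, outside the k
-- binders, in Δ.
substᶜ : ℕ → Ctx → Ctx → Ctx
substᶜ zero    Γ Δ = tailᶜ Γ +ᶜ Δ
substᶜ (suc k) Γ Δ = Γ 0 ∷ᶜ substᶜ k (tailᶜ Γ) Δ

insertᶜ-lookup : ∀ c {M} Γ → insertᶜ c M Γ c ≡ M
insertᶜ-lookup zero    Γ = refl
insertᶜ-lookup (suc c) Γ = insertᶜ-lookup c (tailᶜ Γ)

insertᶜ-∅ : ∀ c → Γ ≗ ∅ → insertᶜ c [] Γ ≗ ∅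
insertᶜ-∅ zero    Γ≗∅ zero    = refl
insertᶜ-∅ zero    Γ≗∅ (suc x) = Γ≗∅ x
insertᶜ-∅ (suc c) Γ≗∅ zero    = Γ≗∅ 0
insertᶜ-∅ (suc c) Γ≗∅ (suc x) = insertᶜ-∅ c (λ y → Γ≗∅ (suc y)) x

insertᶜ-+ᶜ : ∀ c → Γ₁ ≗ insertᶜ c [] Δ₁ → Γ₂ ≗ insertᶜ c [] Δ₂
           → Γ₁ +ᶜ Γ₂ ≗ insertᶜ c [] (Δ₁ +ᶜ Δ₂)
insertᶜ-+ᶜ zero    eq₁ eq₂ zero    = cong₂ _++_ (eq₁ 0) (eq₂ 0)
insertᶜ-+ᶜ zero    eq₁ eq₂ (suc x) = cong₂ _++_ (eq₁ (suc x)) (eq₂ (suc x))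
insertᶜ-+ᶜ (suc c) eq₁ eq₂ zero    = cong₂ _++_ (eq₁ 0) (eq₂ 0)
insertᶜ-+ᶜ (suc c) eq₁ eq₂ (suc x) =
  insertᶜ-+ᶜ c (λ y → eq₁ (suc y)) (λ y → eq₂ (suc y)) x

∶[]-self : ∀ x σ → (x ∶[ σ ]) x ≡ σ ∷ []
∶[]-self zero    σ = refl
∶[]-self (suc x) σ = ∶[]-self x σ

∶[]-insertᶜ-< : ∀ {x c} → x < c → (x ∶[ σ ]) ≗ insertᶜ c [] (x ∶[ σ ])
∶[]-insertᶜ-< {x = zero}  {suc c} _         zero    = refl
∶[]-insertᶜ-< {x = zero}  {suc c} _         (suc y) = sym (insertᶜ-∅ c (λ _ → refl) y)
∶[]-insertᶜ-< {x = suc x} {suc c} _         zero    = refl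
∶[]-insertᶜ-< {x = suc x} {suc c} (s≤s x<c) (suc y) = ∶[]-insertᶜ-< x<c y

∶[]-insertᶜ-≥ : ∀ {x c} → c ≤ x → (suc x ∶[ σ ]) ≗ insertᶜ c [] (x ∶[ σ ])
∶[]-insertᶜ-≥ {x = _}     {zero}  _         zero    = refl
∶[]-insertᶜ-≥ {x = _}     {zero}  _         (suc y) = refl
∶[]-insertᶜ-≥ {x = suc x} {suc c} _         zero    = refl
∶[]-insertᶜ-≥ {x = suc x} {suc c} (s≤s c≤x) (suc y) = ∶[]-insertᶜ-≥ c≤x y

infix 4 _≈ᶜ_ _≈[_]ᶜ_

_≈ᶜ_ : Ctx → Ctx → Set
Γ ≈ᶜ Δ = ∀ x → Γ x ↭ Δ x

≈ᶜ-sym : Γ ≈ᶜ Δ → Δ ≈ᶜ Γ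
≈ᶜ-sym ρ x = ↭-sym (ρ x)

≈ᶜ-trans : Γ ≈ᶜ Δ → Δ ≈ᶜ Δ′ → Γ ≈ᶜ Δ′
≈ᶜ-trans ρ ρ′ x = ↭-trans (ρ x) (ρ′ x)

+ᶜ-cong : Γ₁ ≈ᶜ Δ₁ → Γ₂ ≈ᶜ Δ₂ → Γ₁ +ᶜ Γ₂ ≈ᶜ Δ₁ +ᶜ Δ₂
+ᶜ-cong ρ₁ ρ₂ x = ↭.++⁺ (ρ₁ x) (ρ₂ x)

-- Equal below position k and permutations of each other from k on: under
-- k binders the types of the bound variables must be kept exactly.
_≈[_]ᶜ_ : Ctx → ℕ → Ctx → Set
Γ ≈[ zero  ]ᶜ Δ = Γ ≈ᶜ Δ
Γ ≈[ suc k ]ᶜ Δ = Γ 0 ≡ Δ 0 × tailᶜ Γ ≈[ k ]ᶜ tailᶜ Δ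

≗⇒≈[] : ∀ k → Γ ≗ Δ → Γ ≈[ k ]ᶜ Δ
≗⇒≈[] zero    eq x = ↭-reflexive (eq x)
≗⇒≈[] (suc k) eq   = eq 0 , ≗⇒≈[] k (λ x → eq (suc x))

≈[]-trans : ∀ k → Γ ≈[ k ]ᶜ Δ → Δ ≈[ k ]ᶜ Δ′ → Γ ≈[ k ]ᶜ Δ′
≈[]-trans zero    ρ ρ′ = ≈ᶜ-trans ρ ρ′
≈[]-trans (suc k) (eq , ρ) (eq′ , ρ′) = trans eq eq′ , ≈[]-trans k ρ ρ′

≈[]-+ᶜ : ∀ k → Γ₁ ≈[ k ]ᶜ Δ₁ → Γ₂ ≈[ k ]ᶜ Δ₂ → Γ₁ +ᶜ Γ₂ ≈[ k ]ᶜ Δ₁ +ᶜ Δ₂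
≈[]-+ᶜ zero    ρ₁ ρ₂ = +ᶜ-cong ρ₁ ρ₂
≈[]-+ᶜ (suc k) (eq₁ , ρ₁) (eq₂ , ρ₂) = cong₂ _++_ eq₁ eq₂ , ≈[]-+ᶜ k ρ₁ ρ₂

substᶜ-congˡ : ∀ k → Γ ≗ Γ′ → substᶜ k Γ Δ ≗ substᶜ k Γ′ Δ
substᶜ-congˡ zero    eq x       = cong (_++ _) (eq (suc x))
substᶜ-congˡ (suc k) eq zero    = eq 0
substᶜ-congˡ (suc k) eq (suc x) = substᶜ-congˡ k (λ y → eq (suc y)) x

substᶜ-congʳ : ∀ k Γ → Δ ≈ᶜ Δ′ → substᶜ k Γ Δ ≈[ k ]ᶜ substᶜ k Γ Δ′
substᶜ-congʳ zero    Γ ρ x = ↭.++⁺ˡ (Γ (suc x)) (ρ x)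
substᶜ-congʳ (suc k) Γ ρ   = refl , substᶜ-congʳ k (tailᶜ Γ) ρ

substᶜ-+ᶜ : ∀ k Γ₁ Γ₂ Δ₁ Δ₂
          → substᶜ k Γ₁ Δ₁ +ᶜ substᶜ k Γ₂ Δ₂ ≈[ k ]ᶜ substᶜ k (Γ₁ +ᶜ Γ₂) (Δ₁ +ᶜ Δ₂)
substᶜ-+ᶜ zero    Γ₁ Γ₂ Δ₁ Δ₂ x = ++↭.interchange (Γ₁ (suc x)) (Δ₁ x) (Γ₂ (suc x)) (Δ₂ x)
substᶜ-+ᶜ (suc k) Γ₁ Γ₂ Δ₁ Δ₂   = refl , substᶜ-+ᶜ k (tailᶜ Γ₁) (tailᶜ Γ₂) Δ₁ Δ₂

substᶜ-insertᶜ : ∀ k Γ → Γ ≈[ k ]ᶜ substᶜ k (insertᶜ k [] Γ) ∅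
substᶜ-insertᶜ zero    Γ x = ↭-reflexive (sym (++-identityʳ (Γ x)))
substᶜ-insertᶜ (suc k) Γ   = refl , substᶜ-insertᶜ k (tailᶜ Γ)

liftᶜ-substᶜ : ∀ k → Δ ≈ᶜ Δ′ → liftᶜ k Δ ≈[ k ]ᶜ substᶜ k (k ∶[ σ ]) Δ′
liftᶜ-substᶜ zero    ρ = ρ
liftᶜ-substᶜ (suc k) ρ = refl , liftᶜ-substᶜ k ρ

_++ˢ_ : NS Δ₁ u M m₁ e₁ s₁ → NS Δ₂ u M′ m₂ e₂ s₂
      → ∃[ Δ ] (Δ ≈ᶜ Δ₁ +ᶜ Δ₂ × NS Δ u (M ++ M′) (m₁ + m₂) (e₁ + e₂) (s₁ + s₂))
_++ˢ_ {Δ₂ = Δ₂} []ˢ ds′ = Δ₂ , (λ _ → ↭-refl) , ds′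
_++ˢ_ (_∷ˢ_ {Δ = Δa} {Δs = Δs} {m = mx} {e = ex} {s = sx} {ms = my} {es' = ey} {ss = sy} d ds) ds′
  with ds ++ˢ ds′
... | Δ , ρ , ds″ =
  Δa +ᶜ Δ ,
  (λ x → ↭-trans (↭.++⁺ˡ (Δa x) (ρ x)) (↭-sym (↭.++-assoc (Δa x) (Δs x) _))) ,
  subst₃ (NS _ _ _) (sym (+-assoc mx my _)) (sym (+-assoc ex ey _)) (sym (+-assoc sx sy _)) (d ∷ˢ ds″)

NS-resp-↭ : M ↭ M′ → NS Δ u M m e s → ∃[ Δ′ ] (Δ′ ≈ᶜ Δ × NS Δ′ u M′ m e s)
NS-resp-↭ {Δ = Δ} _↭_.refl ds = Δ , (λ _ → ↭-refl) , ds
NS-resp-↭ (prep _ p) (_∷ˢ_ {Δ = Δa} d ds) with NS-resp-↭ p ds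
... | Δ′ , ρ , ds′ = Δa +ᶜ Δ′ , (λ x → ↭.++⁺ˡ (Δa x) (ρ x)) , d ∷ˢ ds′
NS-resp-↭ (swap _ _ p)
  (_∷ˢ_ {Δ = Δa} {m = mx} {e = ex} {s = sx} d (_∷ˢ_ {Δ = Δb} {m = my} {e = ey} {s = sy} d′ ds))
  with NS-resp-↭ p ds
... | Δ′ , ρ , ds′ =
  Δb +ᶜ (Δa +ᶜ Δ′) ,
  (λ x → ↭-trans (↭.shifts (Δb x) (Δa x)) (↭.++⁺ˡ (Δa x) (↭.++⁺ˡ (Δb x) (ρ x)))) ,
  subst₃ (NS _ _ _) (ℕ+.x∙yz≈y∙xz my mx _) (ℕ+.x∙yz≈y∙xz ey ex _) (ℕ+.x∙yz≈y∙xz sy sx _)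
    (d′ ∷ˢ (d ∷ˢ ds′))
NS-resp-↭ (_↭_.trans p q) ds with NS-resp-↭ p ds
... | _ , ρ , ds′ with NS-resp-↭ q ds′
... | Δ″ , ρ′ , ds″ = Δ″ , ≈ᶜ-trans ρ′ ρ , ds″

strengthen : ∀ c u → N Γ (shift c u) σ m e s → ∃[ Δ ] (Γ ≗ insertᶜ c [] Δ × N Δ u σ m e s)
strengthenˢ : ∀ c u → NS Γ (shift c u) M m e s → ∃[ Δ ] (Γ ≗ insertᶜ c [] Δ × NS Δ u M m e s)

strengthen c (var q) D with compare q c
strengthen .(suc (q + j)) (var q) (var-c .q σ) | less .q j =
  q ∶[ σ ] , ∶[]-insertᶜ-< (s≤s (m≤m+n q j)) , var-c q σ
strengthen .q (var q) (var-c .(suc q) σ) | equal .q =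
  q ∶[ σ ] , ∶[]-insertᶜ-≥ ≤-refl , var-c q σ
strengthen c (var .(suc (c + l))) (var-c .(suc (suc (c + l))) σ) | greater .c l =
  suc (c + l) ∶[ σ ] , ∶[]-insertᶜ-≥ (m≤n⇒m≤1+n (m≤m+n c l)) , var-c _ σ
strengthen c (lam u) (abs-p tτ tΓ D) with strengthen (suc c) u D
... | Δ , eq , d = tailᶜ Δ , (λ x → eq (suc x)) , abs-p tτ (subst TightMTy (eq 0) tΓ) d
strengthen c (lam u) (abs-c {τ = τ} D) with strengthen (suc c) u D
... | Δ , eq , d =
  tailᶜ Δ , (λ x → eq (suc x)) , subst (λ M → N _ (lam u) (M ⇒ τ) _ _ _) (sym (eq 0)) (abs-c d)
strengthen c (app t r) (app-p _ D) with strengthen c t D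
... | Δ , eq , d = Δ , eq , app-p r d
strengthen c (app t r) (app-c D DS) with strengthen c t D | strengthenˢ c r DS
... | Δ₁ , eq₁ , d₁ | Δ₂ , eq₂ , d₂ = Δ₁ +ᶜ Δ₂ , insertᶜ-+ᶜ c eq₁ eq₂ , app-c d₁ d₂
strengthen c (es t r) (es-c D DS) with strengthen (suc c) t D | strengthenˢ c r DS
... | Δ₁ , eq₁ , d₁ | Δ₂ , eq₂ , d₂ =
  tailᶜ Δ₁ +ᶜ Δ₂ , insertᶜ-+ᶜ c (λ x → eq₁ (suc x)) eq₂ ,
  es-c d₁ (subst (λ M → NS Δ₂ r M _ _ _) (eq₁ 0) d₂)

strengthenˢ c u []ˢ = ∅ , (λ x → sym (insertᶜ-∅ c (λ _ → refl) x)) , []ˢ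
strengthenˢ c u (D ∷ˢ DS) with strengthen c u D | strengthenˢ c u DS
... | Δ₁ , eq₁ , d₁ | Δ₂ , eq₂ , d₂ = Δ₁ +ᶜ Δ₂ , insertᶜ-+ᶜ c eq₁ eq₂ , d₁ ∷ˢ d₂

strengthenBy : ∀ k u → N Γ (shiftBy k u) σ m e s → ∃[ Δ ] (Γ ≗ liftᶜ k Δ × N Δ u σ m e s)
strengthenBy {Γ = Γ} zero u D = Γ , (λ _ → refl) , D
strengthenBy (suc k) u D with strengthen 0 (shiftBy k u) D
... | Δ₁ , eq₁ , d₁ with strengthenBy k u d₁
... | Δ , eq , d = Δ , lift-eq , d
  where
    lift-eq : _ ≗ liftᶜ (suc k) Δ
    lift-eq zero    = eq₁ zero
    lift-eq (suc x) = trans (eq₁ (suc x)) (eq x)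

shift-shiftBy : ∀ k u → shift 0 (shiftBy k u) ≡ shiftBy k (shift 0 u)
shift-shiftBy zero    u = refl
shift-shiftBy (suc k) u = cong (shift 0) (shift-shiftBy k u)

data AntiSub (J : Ctx → ℕ → ℕ → ℕ → Set) (k : ℕ) (u : Term) (Γ : Ctx) : ℕ → ℕ → ℕ → Set where
  antiSub : ∀ {Γt Δ mₜ eₜ sₜ mᵤ eᵤ sᵤ} → J Γt mₜ eₜ sₜ → NS Δ u (Γt k) mᵤ eᵤ sᵤ
          → Γ ≈[ k ]ᶜ substᶜ k Γt Δ → AntiSub J k u Γ (mₜ + mᵤ) (eₜ + eᵤ) (sₜ + sᵤ)

antiSub-vacuous : ∀ {J Γt Γ u} k → J Γt m e s → Γt ≗ insertᶜ k [] Γ → AntiSub J k u Γ (m + 0) (e + 0) (s + 0)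
antiSub-vacuous {Γ = Γ} {u} k j eq =
  antiSub j (subst (λ M → NS ∅ u M 0 0 0) (sym (trans (eq k) (insertᶜ-lookup k Γ))) []ˢ)
    (≈[]-trans k (substᶜ-insertᶜ k Γ) (≗⇒≈[] k (substᶜ-congˡ k (λ x → sym (eq x)))))

+-shuffle : ∀ δ w x y z → (δ + (w + x)) + (y + z) ≡ δ + ((w + y) + (x + z))
+-shuffle δ w x y z = trans (+-assoc δ (w + x) (y + z)) (cong (δ +_) (ℕ+.interchange w x y z))

antiSub-+ᶜ : ∀ {J k t r τ M mₜ eₜ sₜ mᵣ eᵣ sᵣ mᵤ eᵤ sᵤ mᵤ′ eᵤ′ sᵤ′} δm δe
           → (N Γ t τ mₜ eₜ sₜ → NS Γr r M mᵣ eᵣ sᵣ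
              → J (Γt +ᶜ Γr) (δm + (mₜ + mᵣ)) (δe + (eₜ + eᵣ)) (sₜ + sᵣ))
           → N Γ t τ mₜ eₜ sₜ → NS Γr r M mᵣ eᵣ sᵣ
           → NS Δ₁ u (Γt k) mᵤ eᵤ sᵤ → NS Δ₂ u (Γr k) mᵤ′ eᵤ′ sᵤ′
           → Γ₁ ≈[ k ]ᶜ substᶜ k Γt Δ₁ → Γ₂ ≈[ k ]ᶜ substᶜ k Γr Δ₂
           → AntiSub J k u (Γ₁ +ᶜ Γ₂) (δm + ((mₜ + mᵤ) + (mᵣ + mᵤ′)))
                                       (δe + ((eₜ + eᵤ) + (eᵣ + eᵤ′))) ((sₜ + sᵤ) + (sᵣ + sᵤ′))
antiSub-+ᶜ {Γr = Γr} {Γt = Γt} {Δ₁ = Δ₁} {Δ₂ = Δ₂} {k = k}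
           {mₜ = mₜ} {eₜ} {sₜ} {mᵣ} {eᵣ} {sᵣ} {mᵤ} {eᵤ} {sᵤ} {mᵤ′} {eᵤ′} {sᵤ′}
           δm δe combine dt dr du₁ du₂ ρ₁ ρ₂
  with du₁ ++ˢ du₂
... | Δ , Δ≈ , du =
  subst₃ (AntiSub _ k _ _) (+-shuffle δm mₜ mᵣ mᵤ mᵤ′) (+-shuffle δe eₜ eᵣ eᵤ eᵤ′) (+-shuffle 0 sₜ sᵣ sᵤ sᵤ′)
    (antiSub (combine dt dr) du
      (≈[]-trans k (≈[]-+ᶜ k ρ₁ ρ₂)
        (≈[]-trans k (substᶜ-+ᶜ k Γt Γr Δ₁ Δ₂) (substᶜ-congʳ k (Γt +ᶜ Γr) (≈ᶜ-sym Δ≈)))))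

antisubstitution : ∀ k u t → N Γ (sub k u t) σ m e s → AntiSub (λ Γt → N Γt t σ) k u Γ m e s
antisubstitutionˢ : ∀ k u t → NS Γ (sub k u t) M m e s → AntiSub (λ Γt → NS Γt t M) k u Γ m e s

antisubstitution k u (var q) D with compare q k
antisubstitution .(suc (q + j)) u (var q) (var-c .q σ) | less .q j =
  antiSub-vacuous (suc (q + j)) (var-c q σ) (∶[]-insertᶜ-< (s≤s (m≤m+n q j)))
antisubstitution {Γ = Γ} {σ = σ} {m} {e} {s} k u (var .k) D | equal .k with strengthenBy k u D
... | Δ , Γ≗ , d =
  subst₃ (AntiSub _ k u Γ) (+-identityʳ m) (+-identityʳ e) (+-identityʳ s)
    (antiSub (var-c k σ) (subst (λ M → NS (Δ +ᶜ ∅) u M _ _ _) (sym (∶[]-self k σ)) (d ∷ˢ []ˢ))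
      (≈[]-trans k (≗⇒≈[] k Γ≗) (liftᶜ-substᶜ k (λ x → ↭-reflexive (sym (++-identityʳ (Δ x)))))))
antisubstitution k u (var .(suc (k + l))) (var-c .(k + l) σ) | greater .k l =
  antiSub-vacuous k (var-c _ σ) (∶[]-insertᶜ-≥ (m≤m+n k l))
antisubstitution k u (lam t) (abs-p tτ tΓ D) with antisubstitution (suc k) u t D
... | antiSub dt du (eq , ρ) = antiSub (abs-p tτ (subst TightMTy eq tΓ) dt) du ρ
antisubstitution k u (lam t) (abs-c {τ = τ} D) with antisubstitution (suc k) u t D
... | antiSub dt du (eq , ρ) =
  antiSub (subst (λ M → N _ (lam t) (M ⇒ τ) _ _ _) (sym eq) (abs-c dt)) du ρ
antisubstitution k u (app t r) (app-p _ D) with antisubstitution k u t D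
... | antiSub dt du ρ = antiSub (app-p r dt) du ρ
antisubstitution k u (app t r) (app-c D DS) with antisubstitution k u t D | antisubstitutionˢ k u r DS
... | antiSub dt du₁ ρ₁ | antiSub dr du₂ ρ₂ = antiSub-+ᶜ 1 1 app-c dt dr du₁ du₂ ρ₁ ρ₂
antisubstitution k u (es t r) (es-c D DS) with antisubstitution (suc k) u t D | antisubstitutionˢ k u r DS
... | antiSub dt du₁ (eq , ρ₁) | antiSub dr du₂ ρ₂ =
  antiSub-+ᶜ 0 1 (λ dt dr → es-c dt (subst (λ M → NS _ r M _ _ _) eq dr)) dt dr du₁ du₂ ρ₁ ρ₂

antisubstitutionˢ k u t []ˢ = antiSub-vacuous k []ˢ (λ x → sym (insertᶜ-∅ k (λ _ → refl) x))
antisubstitutionˢ k u t (D ∷ˢ DS) with antisubstitution k u t D | antisubstitutionˢ k u t DS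
... | antiSub dt du₁ ρ₁ | antiSub dr du₂ ρ₂ = antiSub-+ᶜ 0 0 _∷ˢ_ dt dr du₁ du₂ ρ₁ ρ₂

data AppPremises (Γ : Ctx) (f u : Term) (σ : Ty) : ℕ → ℕ → ℕ → Set where
  premises : ∀ {G D M m₁ e₁ s₁ m₂ e₂ s₂} → N G f (M ⇒ σ) m₁ e₁ s₁ → NS D u M m₂ e₂ s₂
           → Γ ≈ᶜ G +ᶜ D → AppPremises Γ f u σ (m₁ + m₂) (suc (e₁ + e₂)) (s₁ + s₂)

dB-inversion : ∀ L t u → N Γ (plug L (es t (shiftBy (length L) u))) σ m e s
             → AppPremises Γ (plug L (lam t)) u σ m e s
dB-inversion [] t u (es-c D DS) = premises (abs-c D) DS (λ _ → ↭-refl)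
dB-inversion {σ = σ} (r ∷ L) t u (es-c {Γ = Γ₁} {Δ = Γ₂} D DS)
  with dB-inversion L t (shift 0 u) (subst (λ v → N Γ₁ (plug L (es t v)) σ _ _ _) (shift-shiftBy (length L) u) D)
... | premises {G = G} {D = D₀} {m₁ = m₁} {e₁} {s₁} {m₂} {e₂} {s₂} df du ρ with strengthenˢ 0 u du
... | D′ , D₀≗ , du′ with NS-resp-↭ Γ₁0↭G0 DS
  where
    Γ₁0↭G0 : Γ₁ 0 ↭ G 0
    Γ₁0↭G0 = ↭-trans (ρ 0) (↭-reflexive (trans (cong (G 0 ++_) (D₀≗ 0)) (++-identityʳ (G 0))))
... | Γ₂′ , Γ₂′≈ , dr =
  subst₃ (AppPremises _ _ u σ)
    (ℕ+.xy∙z≈xz∙y m₁ _ m₂) (cong suc (cong suc (ℕ+.xy∙z≈xz∙y e₁ _ e₂))) (ℕ+.xy∙z≈xz∙y s₁ _ s₂)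
    (premises (es-c df dr) du′ ρ′)
  where
    open PermutationReasoning
    ρ′ : tailᶜ Γ₁ +ᶜ Γ₂ ≈ᶜ (tailᶜ G +ᶜ Γ₂′) +ᶜ D′
    ρ′ x = begin
      Γ₁ (suc x) ++ Γ₂ x                 ↭⟨ ↭.++⁺ (ρ (suc x)) (↭-sym (Γ₂′≈ x)) ⟩
      (G (suc x) ++ D₀ (suc x)) ++ Γ₂′ x ≡⟨ cong (λ M → (G (suc x) ++ M) ++ Γ₂′ x) (D₀≗ (suc x)) ⟩
      (G (suc x) ++ D′ x) ++ Γ₂′ x       ↭⟨ ++↭.xy∙z≈xz∙y (G (suc x)) (D′ x) (Γ₂′ x) ⟩
      (G (suc x) ++ Γ₂′ x) ++ D′ x       ∎

CounterRel-app : ∀ k {m e m′ e′} m₂ e₂ → CounterRel k m e m′ e′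
               → CounterRel k (suc (m + m₂)) (suc (e + e₂)) (suc (m′ + m₂)) (suc (e′ + e₂))
CounterRel-app m-step {m′ = m′} m₂ e₂ (refl , refl) = cong suc (ℕ+.xy∙z≈xz∙y m′ m₂ 1) , refl
CounterRel-app e-step {e′ = e′} m₂ e₂ (refl , refl) = cong suc (ℕ+.xy∙z≈xz∙y e′ e₂ 1) , refl

Expansion : Kind → Ctx → Term → Ty → ℕ → ℕ → ℕ → Set
Expansion k Γ t σ m′ e′ s =
  ∃[ Γ₀ ] (Γ₀ ≈ᶜ Γ × ∃[ m ] ∃[ e ] (N Γ₀ t σ m e s × CounterRel k m e m′ e′))

-- Abstractions must be typed at a tight type: an abs-c typing of λx.t′
-- fixes the multiset Γ(x), which an expansion of t′ recovers only up to
-- permutation.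
expand : ∀ {t t′ k} → t ⟶dn[ k ] t′ → N Γ t′ σ m e s → (∀ {b} → t ≡ lam b → Tight σ)
       → Expansion k Γ t σ m e s
expand (dB L t u) D _ with dB-inversion L t u D
... | premises df du ρ = _ , ≈ᶜ-sym ρ , _ , _ , app-c df du , +-comm _ 1 , refl
expand (sb t u) D _ with antisubstitution 0 u t D
... | antiSub dt du ρ = _ , ≈ᶜ-sym ρ , _ , _ , es-c dt du , +-comm _ 1 , refl
expand (appL u step _) (app-p _ D) _ with expand step D (λ _ → tight-n)
... | Γ₀ , ρ , m , e , D′ , cr = Γ₀ , ρ , m , e , app-p u D′ , cr
expand {k = k} (appL u step ¬abs) (app-c {Δ = Δ} {m' = m₂} {e' = e₂} D DS) _
  with expand step D (λ {b} eq → ⊥-elim (¬abs ([] , b , eq)))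
... | Γ₀ , ρ , m , e , D′ , cr =
  Γ₀ +ᶜ Δ , (λ x → ↭.++⁺ʳ (Δ x) (ρ x)) , _ , _ , app-c D′ DS , CounterRel-app k m₂ e₂ cr
expand (absC step) (abs-c D) abs⇒tight with abs⇒tight refl
... | ()
expand (absC step) (abs-p tτ tΓ D) _ with expand step D (λ _ → tτ)
... | Γ₀ , ρ , m , e , D′ , cr =
  tailᶜ Γ₀ , (λ x → ρ (suc x)) , m , e , abs-p tτ (↭.All-resp-↭ (↭-sym (ρ 0)) tΓ) D′ , cr

lemma3p9 : ∀ {Γ : Ctx} {t t' : Term} {σ : Ty} {m' e' s : ℕ} {k : Kind}
    → TightCtx Γ → Tight σ → N Γ t' σ m' e' s
    → t ⟶dn[ k ] t'
    → ∃[ Γ₀ ] ((∀ x → Γ₀ x ↭ Γ x) × ∃[ m ] ∃[ e ] (N Γ₀ t σ m e s × CounterRel k m e m' e'))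
lemma3p9 _ tight-σ D step = expand step D (λ _ → tight-σ)
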